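{- Let $c:\mathbb{N}\to\mathbb{N}$ be a surjective colouring of the vertices of the board $K^{\aleph_0}$ (vertex set $\mathbb{N}$, all pairs as edges) such that $|c^{ -1}(i)|=\aleph_0$ for every $i\in\mathbb{N}$. In the Maker–Breaker game on this board, Maker wins if, after all turns have been played, her graph $G_M$ contains a complete subgraph on countably infinitely many vertices which contains infinitely many vertices of colour $i$ for every $i\in\mathbb{N}$. Then Breaker has a winning strategy.
   Context: Maker–Breaker game: Maker and Breaker alternately claim one previously unclaimed edge of the board per turn; the game lasts $\omega$ turns; $G_M$ is the graph of edges claimed by Maker; Breaker wins iff Maker does not. The colouring $c$ is fixed and known before the game starts. -}

module Defs where

open import Data.Nat using (ℕ; zero; suc; _<_; _≤_)
open import Data.Product using (_×_; _,_; proj₁; proj₂; Σ; ∃; ∃-syntax)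
open import Data.Sum using (_⊎_)
open import Data.List using (List; []; _∷_)
open import Data.List.Relation.Unary.Any using (Any)
open import Relation.Binary.PropositionalEquality using (_≡_; _≢_)
open import Relation.Nullary using (¬_)
open import Function using (Surjective)

-- Board K^{ℵ0}: vertex set ℕ, every pair {u,v} with u ≠ v is an edge.
-- An edge is represented by an ordered pair of endpoints; (u , v) and
-- (v , u) denote the same edge (see SameEdge).
Edge : Set
Edge = ℕ × ℕ

SameEdge : Edge → Edge → Set
SameEdge (u , v) (x , y) = (u ≡ x × v ≡ y) ⊎ (u ≡ y × v ≡ x)

-- A history is the list of all edges claimed so far, most recent first.
History : Set
History = List Edge

Strategy : Set
Strategy = History → Edge

Legal : Edge → History → Set
Legal e h = (proj₁ e ≢ proj₂ e) × ¬ Any (SameEdge e) h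

module Play (τ : Strategy) (σ : Strategy) where
  mutual
    hist : ℕ → History
    hist zero = []
    hist (suc n) = breakerMove n ∷ makerMove n ∷ hist n

    makerMove : ℕ → Edge
    makerMove n = τ (hist n)

    breakerMove : ℕ → Edge
    breakerMove n = σ (makerMove n ∷ hist n)

  MakerAdj : ℕ → ℕ → Set
  MakerAdj u v = ∃[ n ] SameEdge (makerMove n) (u , v)

  MakerLegal : Set
  MakerLegal = ∀ n → Legal (makerMove n) (hist n)

  BreakerLegal : Set
  BreakerLegal = ∀ n → (∀ k → k ≤ n → Legal (makerMove k) (hist k))
                     → Legal (breakerMove n) (makerMove n ∷ hist n)

InfiniteRainbowClique : (ℕ → ℕ) → (ℕ → ℕ → Set) → Set
InfiniteRainbowClique c adj =
  Σ (ℕ → ℕ) λ v →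
    (∀ j k → j ≢ k → v j ≢ v k) ×
    (∀ j k → j ≢ k → adj (v j) (v k)) ×
    (∀ i N → ∃[ k ] (N < k × c (v k) ≡ i))

MakerWins : (ℕ → ℕ) → Strategy → Strategy → Set
MakerWins c τ σ = InfiniteRainbowClique c (Play.MakerAdj τ σ)

BreakerWinning : (ℕ → ℕ) → Strategy → Set
BreakerWinning c σ = ∀ (τ : Strategy) →
  Play.BreakerLegal τ σ × (Play.MakerLegal τ σ → ¬ MakerWins c τ σ)

InfiniteFibres : (ℕ → ℕ) → Set
InfiniteFibres c = ∀ i N → ∃[ v ] (N < v × c v ≡ i)

-- Breaker tags Maker's s-th edge with the label ℓ s, the total colour weight of the
-- board Breaker has seen at that moment. The label exceeds the colour of every vertex
-- touched so far and strictly increases with s. Whenever Maker claims an edge uy such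
-- that y has colour ℓ t and Maker's t-th edge is uw, Breaker answers with wy; since y
-- only enters the game after round t, this pattern singles out t and w. A rainbow
-- clique through u and w contains some y of colour ℓ t, and of the two edges uy, wy
-- Maker has to claim one first, whereupon Breaker takes the other.
module Submission where

open import Defs
open import Data.Nat using (ℕ; suc; _+_; _≤_; _<_; s≤s; z<s; _≤′_; ≤′-reflexive; ≤′-step; _≟_)
open import Data.Nat.Properties
  using (≤-refl; ≤-trans; <-irrefl; <-asym; <-cmp; <-trans; ≤-<-trans; <-≤-trans; <⇒≤; <⇒≢; ≰⇒>; ≤⇒≤′;
         m≤n+m; m≤m+n; 1+n≢n)
open import Data.Product using (Σ; _×_; _,_; proj₁; proj₂; ∃-syntax)
open import Data.Sum using (_⊎_; inj₁; inj₂)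
open import Data.List using ([]; _∷_)
open import Data.List.Relation.Unary.Any using (Any; here; there; any?)
import Data.List.Relation.Unary.Any as Any
open import Data.Maybe using (Maybe; just; nothing; _<∣>_)
import Data.Maybe as Maybe
open import Data.Maybe.Properties using (just-injective; map-just)
open import Data.Empty using (⊥)
open import Relation.Binary.Definitions using (tri<; tri≈; tri>)
open import Relation.Binary.PropositionalEquality using (_≡_; _≢_; refl; sym; trans; cong; subst)
open import Relation.Nullary using (¬_; Dec; yes; no)
open import Relation.Nullary.Decidable using (_×-dec_; _⊎-dec_; ¬?)
open import Function using (Surjective; id; _∘_)

sameEdge-sym : ∀ {e f} → SameEdge e f → SameEdge f e
sameEdge-sym (inj₁ (refl , refl)) = inj₁ (refl , refl)
sameEdge-sym (inj₂ (refl , refl)) = inj₂ (refl , refl)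

sameEdge-trans : ∀ {e f g} → SameEdge e f → SameEdge f g → SameEdge e g
sameEdge-trans (inj₁ (refl , refl)) q = q
sameEdge-trans (inj₂ (refl , refl)) (inj₁ (refl , refl)) = inj₂ (refl , refl)
sameEdge-trans (inj₂ (refl , refl)) (inj₂ (refl , refl)) = inj₁ (refl , refl)

sameEdge-flip : ∀ {e u w} → SameEdge e (u , w) → SameEdge e (w , u)
sameEdge-flip (inj₁ (p , q)) = inj₂ (p , q)
sameEdge-flip (inj₂ (p , q)) = inj₁ (p , q)

sameEdge? : ∀ e f → Dec (SameEdge e f)
sameEdge? (u , v) (x , y) = ((u ≟ x) ×-dec (v ≟ y)) ⊎-dec ((u ≟ y) ×-dec (v ≟ x))

legal? : ∀ e h → Dec (Legal e h)
legal? e h = ¬? (proj₁ e ≟ proj₂ e) ×-dec ¬? (any? (sameEdge? e) h)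

Incident : ℕ → Edge → Set
Incident x (u , v) = x ≡ u ⊎ x ≡ v

sameEdge⇒incident₁ : ∀ {e u w} → SameEdge e (u , w) → Incident u e
sameEdge⇒incident₁ (inj₁ (p , _)) = inj₁ (sym p)
sameEdge⇒incident₁ (inj₂ (_ , p)) = inj₂ (sym p)

sameEdge⇒incident₂ : ∀ {e u w} → SameEdge e (u , w) → Incident w e
sameEdge⇒incident₂ e≈uw = sameEdge⇒incident₁ (sameEdge-flip e≈uw)

other : ℕ → Edge → Maybe ℕ
other a e with a ≟ proj₁ e | a ≟ proj₂ e
... | yes _ | _     = just (proj₂ e)
... | no _  | yes _ = just (proj₁ e)
... | no _  | no _  = nothing

other-incident : ∀ {a e z} → other a e ≡ just z → Incident a e
other-incident {a} {e} eq with a ≟ proj₁ e | a ≟ proj₂ e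
... | yes a≡u | _       = inj₁ a≡u
... | no _    | yes a≡v = inj₂ a≡v
other-incident () | no _ | no _

-- No assumption u ≢ w is needed: for a loop both endpoints are the "other" one.
other-sameEdge : ∀ {e u w} → SameEdge e (u , w) → other u e ≡ just w
other-sameEdge {u = u} (inj₁ (refl , refl)) with u ≟ u
... | yes _ = refl
... | no u≢u with () ← u≢u refl
other-sameEdge {u = u} {w} (inj₂ (refl , refl)) with u ≟ w | u ≟ u
... | yes refl | _     = refl
... | no _     | yes _ = refl
... | no _     | no u≢u with () ← u≢u refl

weight : (ℕ → ℕ) → History → ℕ
weight f []            = 0
weight f ((u , v) ∷ h) = suc (f u + f v + weight f h)

weight-< : ∀ f e h → weight f h < weight f (e ∷ h)
weight-< f (u , v) h = s≤s (m≤n+m (weight f h) (f u + f v))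

incident⇒<weight : ∀ f {x} h → Any (Incident x) h → f x < weight f h
incident⇒<weight f ((u , v) ∷ h) (here (inj₁ refl)) =
  s≤s (≤-trans (m≤m+n (f u) (f v)) (m≤m+n _ (weight f h)))
incident⇒<weight f ((u , v) ∷ h) (here (inj₂ refl)) =
  s≤s (≤-trans (m≤n+m (f v) (f u)) (m≤m+n _ (weight f h)))
incident⇒<weight f ((u , v) ∷ h) (there x∈h) =
  ≤-trans (incident⇒<weight f h x∈h) (<⇒≤ (weight-< f (u , v) h))

freshEdge : History → Edge
freshEdge h = weight id h , suc (weight id h)

freshEdge-legal : ∀ h → Legal (freshEdge h) h
freshEdge-legal h =
  (λ eq → 1+n≢n (sym eq)) ,
  λ claimed → <-irrefl refl
    (incident⇒<weight id h (Any.map (sameEdge⇒incident₁ ∘ sameEdge-sym) claimed))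

orFresh : Maybe Edge → History → Edge
orFresh nothing  h = freshEdge h
orFresh (just e) h with legal? e h
... | yes _ = e
... | no _  = freshEdge h

orFresh-legal : ∀ me h → Legal (orFresh me h) h
orFresh-legal nothing  h = freshEdge-legal h
orFresh-legal (just e) h with legal? e h
... | yes legal = legal
... | no _      = freshEdge-legal h

orFresh-just : ∀ {e} h → Legal e h → orFresh (just e) h ≡ e
orFresh-just {e} h legal with legal? e h
... | yes _       = refl
... | no ¬legal with () ← ¬legal legal

map-just⁻ : ∀ {A B : Set} {f : A → B} ma {y} → Maybe.map f ma ≡ just y → ∃[ x ] (ma ≡ just x × f x ≡ y)
map-just⁻ (just x) refl = x , refl , refl

<∣>-just⁻ : ∀ {A : Set} (ma mb : Maybe A) {x} → (ma <∣> mb) ≡ just x → ma ≡ just x ⊎ mb ≡ just x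
<∣>-just⁻ (just _) mb eq = inj₁ eq
<∣>-just⁻ nothing  mb eq = inj₂ eq

module BreakerStrategy (c : ℕ → ℕ) where

  -- Maker claims ab; x is an earlier Maker edge carrying label k. If c b ≡ k and
  -- x = az, then Breaker should claim zb.
  answer : ℕ → ℕ → Edge → ℕ → Maybe Edge
  answer a b x k with c b ≟ k
  ... | yes _ = Maybe.map (_, b) (other a x)
  ... | no _  = nothing

  answer-sound : ∀ {a b x k e} → answer a b x k ≡ just e →
                 c b ≡ k × ∃[ z ] (other a x ≡ just z × e ≡ (z , b))
  answer-sound {a} {b} {x} {k} eq with c b ≟ k
  ... | yes cb≡k with z , other≡z , refl ← map-just⁻ (other a x) eq = cb≡k , z , other≡z , refl
  answer-sound () | no _

  answer-hit : ∀ {a b x k z} → c b ≡ k → other a x ≡ just z → answer a b x k ≡ just (z , b)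
  answer-hit {b = b} {k = k} cb≡k eq with c b ≟ k
  ... | yes _   = map-just eq
  ... | no cb≢k with () ← cb≢k cb≡k

  threat : Edge → Edge → ℕ → Maybe Edge
  threat (a , b) x k = answer a b x k <∣> answer b a x k

  threat-sound : ∀ {m a b x k e} → SameEdge m (a , b) → threat m x k ≡ just e →
                 answer a b x k ≡ just e ⊎ answer b a x k ≡ just e
  threat-sound {a = a} {b} {x} {k} (inj₁ (refl , refl)) eq = <∣>-just⁻ (answer a b x k) _ eq
  threat-sound {a = a} {b} {x} {k} (inj₂ (refl , refl)) eq with <∣>-just⁻ (answer b a x k) _ eq
  ... | inj₁ found = inj₂ found
  ... | inj₂ found = inj₁ found

  threat-complete : ∀ {m a b x k e} → SameEdge m (a , b) → answer a b x k ≡ just e →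
                    ∃[ e′ ] threat m x k ≡ just e′
  threat-complete (inj₁ (refl , refl)) eq rewrite eq = _ , refl
  threat-complete {a = a} {b} {x} {k} (inj₂ (refl , refl)) eq with answer b a x k
  ... | just e′ = e′ , refl
  ... | nothing = _ , eq

  -- A history seen by Breaker alternates Breaker's and Maker's edges, most recent first;
  -- each Maker edge x is labelled by the weight of the history ending in x.
  search : Edge → History → Maybe Edge
  search m (_ ∷ x ∷ h) = threat m x (weight c (x ∷ h)) <∣> search m h
  search m _           = nothing

  suggestion : History → Maybe Edge
  suggestion []      = nothing
  suggestion (m ∷ h) = search m h

  breaker : Strategy
  breaker h = orFresh (suggestion h) h

  module AgainstMaker (τ : Strategy) where
    open Play τ breaker

    claimed : ℕ → History
    claimed s = makerMove s ∷ hist s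

    label : ℕ → ℕ
    label s = weight c (claimed s)

    breaker-legal : BreakerLegal
    breaker-legal n _ = orFresh-legal (suggestion (claimed n)) (claimed n)

    hist-⊆ : ∀ {P : Edge → Set} {s t} → s ≤′ t → Any P (hist s) → Any P (hist t)
    hist-⊆ (≤′-reflexive refl) p = p
    hist-⊆ (≤′-step s≤t) p = there (there (hist-⊆ s≤t p))

    claimed-⊆ : ∀ {P : Edge → Set} {s t} → s ≤′ t → Any P (claimed s) → Any P (claimed t)
    claimed-⊆ (≤′-reflexive refl) p = p
    claimed-⊆ (≤′-step s≤t) p = there (there (claimed-⊆ s≤t p))

    label-<-suc : ∀ t → label t < label (suc t)
    label-<-suc t = <-trans (weight-< c (breakerMove t) (claimed t)) (weight-< c (makerMove (suc t)) (hist (suc t)))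

    label-mono-≤ : ∀ {s t} → s ≤′ t → label s ≤ label t
    label-mono-≤ (≤′-reflexive refl)       = ≤-refl
    label-mono-≤ {t = suc t} (≤′-step s≤t) = ≤-trans (label-mono-≤ s≤t) (<⇒≤ (label-<-suc t))

    label-mono-< : ∀ {s t} → s < t → label s < label t
    label-mono-< {t = suc t} (s≤s s≤t) = ≤-<-trans (label-mono-≤ (≤⇒≤′ s≤t)) (label-<-suc t)

    label-injective : ∀ {s t} → label s ≡ label t → s ≡ t
    label-injective {s} {t} eq with <-cmp s t
    ... | tri< s<t _ _ with () ← <⇒≢ (label-mono-< s<t) eq
    ... | tri≈ _ s≡t _ = s≡t
    ... | tri> _ _ t<s with () ← <⇒≢ (label-mono-< t<s) (sym eq)

    colour-<-label : ∀ {x s t} → s ≤ t → Incident x (makerMove s) → c x < label t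
    colour-<-label {t = t} s≤t x∈s =
      incident⇒<weight c (claimed t) (claimed-⊆ (≤⇒≤′ s≤t) (here x∈s))

    touched-after : ∀ {y s t} → c y ≡ label t → Incident y (makerMove s) → t < s
    touched-after cy y∈s = ≰⇒> λ s≤t → <-irrefl cy (colour-<-label s≤t y∈s)

    search-finds : ∀ {m f t} n → (∀ s {e} → threat m (makerMove s) (label s) ≡ just e → e ≡ f) →
                   t < n → ∃[ e ] threat m (makerMove t) (label t) ≡ just e →
                   search m (hist n) ≡ just f
    search-finds {m} {f} {t} (suc n) unique t<1+n found
      with threat m (makerMove n) (label n) in eq
    ... | just e rewrite unique n eq = refl
    ... | nothing with <-cmp t n
    ...   | tri< t<n _ _ = search-finds n unique t<n found
    ...   | tri≈ _ refl _ with () ← trans (sym eq) (proj₂ found)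
    ...   | tri> _ _ n<t with () ← <-irrefl refl (<-≤-trans t<1+n n<t)

    module Triangle {u w y t : ℕ} (t≈uw : SameEdge (makerMove t) (u , w)) (cy : c y ≡ label t) where

      answer-via-u : ∀ s {e} → answer u y (makerMove s) (label s) ≡ just e → e ≡ (w , y)
      answer-via-u s eq with answer-sound eq
      ... | cy′ , z , other≡z , refl with label-injective (trans (sym cy′) cy)
      ...   | refl = cong (_, y) (just-injective (trans (sym other≡z) (other-sameEdge t≈uw)))

      no-answer-via-y : ∀ s {e} → answer y u (makerMove s) (label s) ≡ just e → ⊥
      no-answer-via-y s eq with answer-sound eq
      ... | cu , _ , other≡z , _ =
        <-asym (touched-after cy (other-incident other≡z))
               (touched-after cu (sameEdge⇒incident₁ t≈uw))

      breaker-answers : ∀ {p} → SameEdge (makerMove p) (u , y) → w ≢ y →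
                        ¬ Any (SameEdge (w , y)) (claimed p) → breakerMove p ≡ (w , y)
      breaker-answers {p} p≈uy w≢y unclaimed =
        trans (cong (λ me → orFresh me (claimed p)) searched)
              (orFresh-just (claimed p) (w≢y , unclaimed))
        where
        unique : ∀ s {e} → threat (makerMove p) (makerMove s) (label s) ≡ just e → e ≡ (w , y)
        unique s eq with threat-sound p≈uy eq
        ... | inj₁ via-u = answer-via-u s via-u
        ... | inj₂ via-y with () ← no-answer-via-y s via-y

        answered-at-t : ∃[ e ] threat (makerMove p) (makerMove t) (label t) ≡ just e
        answered-at-t = threat-complete p≈uy (answer-hit cy (other-sameEdge t≈uw))

        searched : search (makerMove p) (hist p) ≡ just (w , y)
        searched = search-finds p unique (touched-after cy (sameEdge⇒incident₂ p≈uy)) answered-at-t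

      maker-cannot-close : MakerLegal → w ≢ y → ∀ {p q} →
                           SameEdge (makerMove p) (u , y) → SameEdge (makerMove q) (w , y) → p < q → ⊥
      maker-cannot-close legal w≢y {p} {q} p≈uy q≈wy p<q = taken-by-breaker (taken ∘ there)
        where
        taken : Any (SameEdge (w , y)) (hist (suc p)) → ⊥
        taken old = proj₂ (legal q) (hist-⊆ (≤⇒≤′ p<q) (Any.map (sameEdge-trans q≈wy) old))

        taken-by-breaker : ¬ Any (SameEdge (w , y)) (claimed p) → ⊥
        taken-by-breaker unclaimed =
          taken (here (subst (SameEdge (w , y)) (sym (breaker-answers p≈uy w≢y unclaimed))
                             (inj₁ (refl , refl))))

    no-triangle : ∀ {u w y t} → MakerLegal → SameEdge (makerMove t) (u , w) → c y ≡ label t →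
                  u ≢ w → u ≢ y → w ≢ y → MakerAdj u y → MakerAdj w y → ⊥
    no-triangle legal t≈uw cy u≢w u≢y w≢y (p , p≈uy) (q , q≈wy) with <-cmp p q
    ... | tri< p<q _ _ = Triangle.maker-cannot-close t≈uw cy legal w≢y p≈uy q≈wy p<q
    ... | tri> _ _ q<p = Triangle.maker-cannot-close (sameEdge-flip t≈uw) cy legal u≢y q≈wy p≈uy q<p
    ... | tri≈ _ refl _ with sameEdge-trans (sameEdge-sym p≈uy) q≈wy
    ...   | inj₁ (u≡w , _) = u≢w u≡w
    ...   | inj₂ (u≡y , _) = u≢y u≡y

    breaker-wins : MakerLegal → ¬ MakerWins c τ breaker
    breaker-wins legal (v , injective , adjacent , rainbow)
      with t , t≈uw ← adjacent 0 1 (λ ())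
      with k , 1<k , cy ← rainbow (label t) 1
      = no-triangle legal t≈uw cy
          (injective 0 1 (λ ())) (injective 0 k (<⇒≢ (<-trans z<s 1<k))) (injective 1 k (<⇒≢ 1<k))
          (adjacent 0 k (<⇒≢ (<-trans z<s 1<k))) (adjacent 1 k (<⇒≢ 1<k))

mainTheorem5 : (c : ℕ → ℕ) → Surjective _≡_ _≡_ c → InfiniteFibres c →
    Σ Strategy λ σ → BreakerWinning c σ
mainTheorem5 c _ _ = breaker , λ τ → AgainstMaker.breaker-legal τ , AgainstMaker.breaker-wins τ
  where open BreakerStrategy c
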